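{- Let $k\ge 2$ and let $n=3b+2$ for some positive integer $b$. Then $va^\equiv_1(K_{k*n})=kb+k$.
   Context: All graphs are finite and simple. For a graph $G$ with $N=|V(G)|$ vertices, an equitable $(q,r)$-tree-coloring of $G$ is a partition of $V(G)$ into $q$ sets, each of size $\lfloor N/q\rfloor$ or $\lceil N/q\rceil$, such that each set induces a forest of maximum degree at most $r$. The strong equitable vertex $r$-arboricity $va^\equiv_r(G)$ is the minimum $p$ such that $G$ has an equitable $(q,r)$-tree-coloring for every integer $q\ge p$. $K_{k*n}$ denotes the complete $k$-partite graph with every partite set of size $n$. -}

module Defs where

open import Data.Nat using (ℕ; zero; suc; _+_; _*_; _≤_; _<_)
open import Data.Nat.DivMod using (_/_)
open import Data.Fin using (Fin; zero; suc; inject₁; fromℕ; quotient)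
open import Data.Fin.Properties using (_≟_)
open import Data.Vec using (count; allFin)
open import Data.Product using (Σ; _×_; _,_)
open import Data.Sum using (_⊎_)
open import Data.Unit using (⊤)
open import Data.Empty using (⊥)
open import Relation.Nullary using (¬_; Dec; yes; no)
open import Relation.Nullary.Decidable using (_×-dec_; ¬?)
open import Relation.Binary.PropositionalEquality using (_≡_; _≢_)
open import Function.Definitions using (Injective)

record Graph : Set₁ where
  field
    N     : ℕ
    Adj   : Fin N → Fin N → Set
    adj?  : ∀ u v → Dec (Adj u v)
    sym   : ∀ {u v} → Adj u v → Adj v u
    irr   : ∀ {u} → ¬ Adj u u
open Graph public

-- Complete k-partite graph K_{k*n}: vertex v ∈ Fin (k*n) lies in part
-- `quotient n v` ∈ Fin k; two vertices are adjacent iff their parts differ.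
K* : (k n : ℕ) → Graph
K* k n = record
  { N    = k * n
  ; Adj  = λ u v → quotient {k} n u ≢ quotient {k} n v
  ; adj? = λ u v → ¬? (quotient {k} n u ≟ quotient {k} n v)
  ; sym  = λ ne eq → ne (symm eq)
  ; irr  = λ ne → ne Relation.Binary.PropositionalEquality.refl
  }
  where
  symm = Relation.Binary.PropositionalEquality.sym

module _ (G : Graph) {q : ℕ} (f : Fin (N G) → Fin q) where

  classSize : Fin q → ℕ
  classSize i = count (λ u → f u ≟ i) (allFin (N G))

  classDeg : Fin (N G) → ℕ
  classDeg v = count (λ u → adj? G v u ×-dec (f u ≟ f v)) (allFin (N G))

  record MonoCycle (i : Fin q) : Set where
    field
      m     : ℕ
      cyc   : Fin (suc (suc (suc m))) → Fin (N G)
      inj   : Injective _≡_ _≡_ cyc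
      step  : ∀ (j : Fin (suc (suc m))) → Adj G (cyc (inject₁ j)) (cyc (suc j))
      close : Adj G (cyc (fromℕ (suc (suc m)))) (cyc zero)
      mono  : ∀ j → f (cyc j) ≡ i

-- s is ⌊N/q⌋ or ⌈N/q⌉ (only used for q ≥ 1, since a colour i : Fin q exists)
EqSize : (N q s : ℕ) → Set
EqSize N zero    s = ⊤
EqSize N (suc q) s = (s ≡ N / suc q) ⊎ (s ≡ (N + q) / suc q)

record EquitableTreeColoring (G : Graph) (q r : ℕ) : Set where
  field
    col      : Fin (N G) → Fin q
    sizes    : ∀ i → EqSize (N G) q (classSize G col i)
    acyclic  : ∀ i → ¬ MonoCycle G col i
    degBound : ∀ v → classDeg G col v ≤ r

AllFrom : Graph → ℕ → ℕ → Set
AllFrom G r p = ∀ q → p ≤ q → EquitableTreeColoring G q r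

IsStrongEqVA : Graph → ℕ → ℕ → Set
IsStrongEqVA G r p = AllFrom G r p × (∀ p′ → p′ < p → ¬ AllFrom G r p′)

-- For q ≥ kb + k colours an equitable (q,1)-tree-colouring exists: if k(3b+2) ≤ 2q,
-- colour vertex u by u mod q, so that every class has at most two vertices; otherwise
-- use r = k(3b+2) − 2q ≤ kb classes of three vertices from one part (independent sets)
-- and q − r classes of two vertices.  For q = kb + k − 1 there is none.  A class of at
-- least three vertices inducing maximum degree ≤ 1 lies inside one part.  If k ≤ 3,
-- every class has at least three vertices, so a part of size 3b + 2 meets at most b
-- classes and q ≤ kb.  If k ≥ 4, the classes have two or three vertices; as
-- 3b + 2 ≢ 0 (mod 3), every part meets the two-vertex classes in at least two vertices,
-- so there are at least k of them, whereas counting vertices leaves only k − 3.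

module Submission where

open import Defs hiding (sym)
open import Data.Empty using (⊥-elim)
open import Data.Fin using (Fin; zero; suc; toℕ; fromℕ<; combine; quotient; remainder; _↑ˡ_; _↑ʳ_)
open import Data.Fin.Properties using (_≟_; toℕ-fromℕ<; toℕ-injective; toℕ<n; remQuot-combine; suc-injective)
open import Data.Nat as ℕ using (ℕ; zero; suc; _+_; _*_; _∸_; _≤_; _<_; _<?_; _≤?_; z≤n; s≤s; NonZero)
open import Data.Nat.Properties hiding (_≟_; suc-injective)
open import Data.Nat.DivMod
open import Algebra.Properties.Semiring.Sum +-*-semiring
  using (sum; sum-syntax; sum-cong-≗; ∑-distrib-+; ∑-comm; *-distribˡ-sum; *-distribʳ-sum)
open import Function using (_∘_; id; case_of_)
open import Level using (Level)
open import Data.Nat.Divisibility using (_∣_; divides; ∣m∣n⇒∣m+n; ∣m+n∣m⇒∣n; ∣⇒≤; n∣m*n; m∣m*n)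
open import Data.Nat.Tactic.RingSolver using (solve-∀)
open import Data.Product using (∃; _×_; _,_; proj₁; proj₂)
open import Data.Sum using (_⊎_; inj₁; inj₂)
open import Data.Vec using (count; tabulate)
open import Relation.Nullary using (¬_; Dec; yes; no)
open import Relation.Nullary.Decidable using (_×-dec_; ¬?)
open import Relation.Binary.PropositionalEquality

private
  variable
    ℓ ℓ′ : Level
    A : Set ℓ
    B : Set ℓ′

-- Indicators and finite sums

χ : Dec A → ℕ
χ (yes _) = 1
χ (no _)  = 0

χ≤1 : (d : Dec A) → χ d ≤ 1
χ≤1 (yes _) = ≤-refl
χ≤1 (no _)  = z≤n

χ-yes : A → (d : Dec A) → χ d ≡ 1
χ-yes _ (yes _) = refl
χ-yes x (no ¬x) = ⊥-elim (¬x x)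

χ-no : ¬ A → (d : Dec A) → χ d ≡ 0
χ-no ¬x (yes x) = ⊥-elim (¬x x)
χ-no _  (no _)  = refl

χ-pos : (d : Dec A) → 0 < χ d → A
χ-pos (yes x) _ = x

χ-mono : (A → B) → (d : Dec A) (e : Dec B) → χ d ≤ χ e
χ-mono f (yes x) e = ≤-reflexive (sym (χ-yes (f x) e))
χ-mono f (no _)  e = z≤n

χ-cong : (A → B) → (B → A) → (d : Dec A) (e : Dec B) → χ d ≡ χ e
χ-cong f g d e = ≤-antisym (χ-mono f d e) (χ-mono g e d)

χ-fromℕ<≟ : ∀ {q m} .(m<q : m < q) (i : Fin q) → χ (fromℕ< m<q ≟ i) ≡ χ (m ℕ.≟ toℕ i)
χ-fromℕ<≟ m<q i = χ-cong (λ e → trans (sym (toℕ-fromℕ< m<q)) (cong toℕ e)) (λ e → toℕ-injective (trans (toℕ-fromℕ< m<q) e)) _ _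

count≡sum : ∀ {p} {P : A → Set p} (P? : ∀ x → Dec (P x)) n (f : Fin n → A) →
  count P? (tabulate f) ≡ ∑[ i < n ] χ (P? (f i))
count≡sum P? zero    f = refl
count≡sum P? (suc n) f with P? (f zero)
... | yes _ = cong suc (count≡sum P? n (f ∘ suc))
... | no _  = count≡sum P? n (f ∘ suc)

sum-const : ∀ n c → ∑[ i < n ] c ≡ n * c
sum-const zero    c = refl
sum-const (suc n) c = cong (c +_) (sum-const n c)

sum-zero : ∀ n (f : Fin n → ℕ) → (∀ i → f i ≡ 0) → sum f ≡ 0
sum-zero n f f≡0 = trans (sum-cong-≗ f≡0) (trans (sum-const n 0) (*-zeroʳ n))

sum-mono-≤ : ∀ n {f g : Fin n → ℕ} → (∀ i → f i ≤ g i) → sum f ≤ sum g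
sum-mono-≤ zero    f≤g = z≤n
sum-mono-≤ (suc n) f≤g = +-mono-≤ (f≤g zero) (sum-mono-≤ n (f≤g ∘ suc))

term≤sum : ∀ n (f : Fin n → ℕ) i → f i ≤ sum f
term≤sum (suc n) f zero    = m≤m+n (f zero) _
term≤sum (suc n) f (suc i) = ≤-trans (term≤sum n (f ∘ suc) i) (m≤n+m _ (f zero))

sum-pos⇒∃ : ∀ n (f : Fin n → ℕ) → 0 < sum f → ∃ λ i → 0 < f i
sum-pos⇒∃ (suc n) f pos with f zero in f₀
... | suc _ = zero , subst (0 <_) (sym f₀) (s≤s z≤n)
... | zero  = let (i , fi) = sum-pos⇒∃ n (f ∘ suc) pos in suc i , fi

sum-single : ∀ n (f : Fin n → ℕ) i → (∀ j → j ≢ i → f j ≡ 0) → sum f ≡ f i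
sum-single (suc n) f zero    f≡0 =
  trans (cong (f zero +_) (sum-zero n (f ∘ suc) (λ j → f≡0 (suc j) λ ()))) (+-identityʳ _)
sum-single (suc n) f (suc i) f≡0 =
  cong₂ _+_ (f≡0 zero λ ()) (sum-single n (f ∘ suc) i (λ j j≢i → f≡0 (suc j) (j≢i ∘ suc-injective)))

sum-indicator : ∀ n (x : Fin n) → ∑[ i < n ] χ (i ≟ x) ≡ 1
sum-indicator n x = trans (sum-single n _ x (λ j j≢x → χ-no j≢x (j ≟ x))) (χ-yes refl (x ≟ x))

sum-↑ : ∀ m n (f : Fin (m + n) → ℕ) → sum f ≡ ∑[ i < m ] f (i ↑ˡ n) + ∑[ j < n ] f (m ↑ʳ j)
sum-↑ zero    n f = refl
sum-↑ (suc m) n f = trans (cong (f zero +_) (sum-↑ m n (f ∘ suc))) (sym (+-assoc (f zero) _ _))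

sum-combine : ∀ m n (f : Fin (m * n) → ℕ) → sum f ≡ ∑[ i < m ] ∑[ j < n ] f (combine i j)
sum-combine zero    n f = refl
sum-combine (suc m) n f = trans (sum-↑ n (m * n) f) (cong (∑[ j < n ] f (j ↑ˡ (m * n)) +_) (sum-combine m n (f ∘ (n ↑ʳ_))))

∣-sum : ∀ {d} n (f : Fin n → ℕ) → (∀ i → d ∣ f i) → d ∣ sum f
∣-sum zero    f d∣f = divides 0 refl
∣-sum (suc n) f d∣f = ∣m∣n⇒∣m+n (d∣f zero) (∣-sum n (f ∘ suc) (d∣f ∘ suc))

[m*n+o]%n≡o : ∀ m {n o} .{{_ : NonZero n}} → o < n → (m * n + o) % n ≡ o
[m*n+o]%n≡o m {n} {o} o<n = trans (cong (_% n) (+-comm (m * n) o)) (trans ([m+kn]%n≡m%n o m n) (m<n⇒m%n≡m o<n))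

[m*n+o]/n≡m : ∀ m {n o} .{{_ : NonZero n}} → o < n → (m * n + o) / n ≡ m
[m*n+o]/n≡m m {n} {o} o<n = trans (+-distrib-/-∣ˡ o (n∣m*n m)) (trans (cong₂ _+_ (m*n/n≡m m n) (m<n⇒m/n≡0 o<n)) (+-identityʳ m))

m*n≤o⇒n≤o/m : ∀ m {n o} .{{_ : NonZero m}} → m * n ≤ o → n ≤ o / m
m*n≤o⇒n≤o/m m {n} {o} mn≤o = subst (_≤ o / m) (m*n/n≡m n m) (/-monoˡ-≤ m (subst (_≤ o) (*-comm m n) mn≤o))

p*n+j<k*n : ∀ {k n p j} → p < k → j < n → p * n + j < k * n
p*n+j<k*n {k} {n} {p} {j} p<k j<n = begin-strict
  p * n + j    <⟨ +-monoʳ-< (p * n) j<n ⟩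
  p * n + n    ≡⟨ +-comm (p * n) n ⟩
  suc p * n    ≤⟨ *-monoˡ-≤ n p<k ⟩
  k * n        ∎
  where open ≤-Reasoning

slot-injective : ∀ {b p p′ x x′} → x < b → x′ < b → p * b + x ≡ p′ * b + x′ → p ≡ p′
slot-injective {suc b} {p} {p′} x<b x′<b eq =
  trans (sym ([m*n+o]/n≡m p x<b)) (trans (cong (_/ suc b) eq) ([m*n+o]/n≡m p′ x′<b))

x≤1∧3∣y⇒x+y≢3b+2 : ∀ b {x y} → x ≤ 1 → 3 ∣ y → x + y ≢ 3 * b + 2
x≤1∧3∣y⇒x+y≢3b+2 b z≤n       3∣y refl = <⇒≱ (s≤s (s≤s (s≤s z≤n))) (∣⇒≤ (∣m+n∣m⇒∣n 3∣y (m∣m*n b)))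
x≤1∧3∣y⇒x+y≢3b+2 b (s≤s z≤n) 3∣y eq   = <⇒≱ (s≤s (s≤s z≤n)) (∣⇒≤ (∣m+n∣m⇒∣n 3∣3b+1 (m∣m*n b)))
  where
  3∣3b+1 : 3 ∣ 3 * b + 1
  3∣3b+1 = subst (3 ∣_) (cong ℕ.pred (trans eq (+-suc (3 * b) 1))) 3∣y

sumTo : ℕ → (ℕ → ℕ) → ℕ
sumTo m h = ∑[ i < m ] h (toℕ i)

sumTo-cong : ∀ m {h h′ : ℕ → ℕ} → (∀ w → w < m → h w ≡ h′ w) → sumTo m h ≡ sumTo m h′
sumTo-cong m h≡h′ = sum-cong-≗ (λ i → h≡h′ (toℕ i) (toℕ<n i))

sumTo-+ : ∀ m n (h : ℕ → ℕ) → sumTo (m + n) h ≡ sumTo m h + sumTo n (λ w → h (m + w))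
sumTo-+ zero    n h = refl
sumTo-+ (suc m) n h = trans (cong (h 0 +_) (sumTo-+ m n (h ∘ suc))) (sym (+-assoc (h 0) _ _))

sumTo-* : ∀ m n (h : ℕ → ℕ) → sumTo (m * n) h ≡ sumTo m (λ x → sumTo n (λ y → h (x * n + y)))
sumTo-* zero    n h = refl
sumTo-* (suc m) n h = trans (sumTo-+ n (m * n) h) (cong (sumTo n h +_) (trans (sumTo-* m n (h ∘ (n +_)))
  (sumTo-cong m (λ x _ → sumTo-cong n (λ y _ → cong h (sym (+-assoc n (x * n) y)))))))

sumTo-indicator : ∀ m i → sumTo m (λ w → χ (w ℕ.≟ i)) ≡ χ (i <? m)
sumTo-indicator m i with i <? m
... | yes i<m = trans (sum-cong-≗ (λ j → χ-cong (λ e → toℕ-injective (trans e (sym (toℕ-fromℕ< i<m))))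
                                                (λ e → trans (cong toℕ e) (toℕ-fromℕ< i<m)) _ (j ≟ fromℕ< i<m)))
                      (sum-indicator m (fromℕ< i<m))
... | no i≮m  = sum-zero m _ (λ j → χ-no (λ e → i≮m (subst (_< m) e (toℕ<n j))) _)

count-% : ∀ s {r d} .{{_ : NonZero d}} i → r < d → i < d →
  sumTo (s * d + r) (λ w → χ (w % d ℕ.≟ i)) ≡ s + χ (i <? r)
count-% s {r} {d} i r<d i<d = begin
  sumTo (s * d + r) h                                               ≡⟨ sumTo-+ (s * d) r h ⟩
  sumTo (s * d) h + sumTo r (λ w → h (s * d + w))                   ≡⟨ cong₂ _+_ full-blocks last-block ⟩
  s + χ (i <? r)                                                    ∎
  where
  open ≡-Reasoning
  h : ℕ → ℕ
  h w = χ (w % d ℕ.≟ i)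
  full-blocks : sumTo (s * d) h ≡ s
  full-blocks = begin
    sumTo (s * d) h                                                 ≡⟨ sumTo-* s d h ⟩
    sumTo s (λ x → sumTo d (λ y → h (x * d + y)))                   ≡⟨ sumTo-cong s (λ x _ → sumTo-cong d (λ y y<d → cong (λ z → χ (z ℕ.≟ i)) ([m*n+o]%n≡o x y<d))) ⟩
    sumTo s (λ _ → sumTo d (λ y → χ (y ℕ.≟ i)))                     ≡⟨ sumTo-cong s (λ _ _ → trans (sumTo-indicator d i) (χ-yes i<d (i <? d))) ⟩
    sumTo s (λ _ → 1)                                               ≡⟨ trans (sum-const s 1) (*-identityʳ s) ⟩
    s                                                               ∎
  last-block : sumTo r (λ w → h (s * d + w)) ≡ χ (i <? r)
  last-block = trans (sumTo-cong r (λ w w<r → cong (λ z → χ (z ℕ.≟ i)) ([m*n+o]%n≡o s (<-trans w<r r<d))))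
                     (sumTo-indicator r i)

count-/ : ∀ m {d} .{{_ : NonZero d}} i → sumTo (m * d) (λ w → χ (w / d ℕ.≟ i)) ≡ d * χ (i <? m)
count-/ m {d} i = begin
  sumTo (m * d) (λ w → χ (w / d ℕ.≟ i))                             ≡⟨ sumTo-* m d (λ w → χ (w / d ℕ.≟ i)) ⟩
  sumTo m (λ x → sumTo d (λ y → χ ((x * d + y) / d ℕ.≟ i)))        ≡⟨ sumTo-cong m (λ x _ → sumTo-cong d (λ y y<d → cong (λ z → χ (z ℕ.≟ i)) ([m*n+o]/n≡m x y<d))) ⟩
  sumTo m (λ x → sumTo d (λ _ → χ (x ℕ.≟ i)))                      ≡⟨ sumTo-cong m (λ x _ → sum-const d (χ (x ℕ.≟ i))) ⟩
  sumTo m (λ x → d * χ (x ℕ.≟ i))                                   ≡⟨ sym (*-distribˡ-sum {m} d _) ⟩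
  d * sumTo m (λ x → χ (x ℕ.≟ i))                                   ≡⟨ cong (d *_) (sumTo-indicator m i) ⟩
  d * χ (i <? m)                                                    ∎
  where open ≡-Reasoning

eqSize-floorOrCeil : ∀ s {r q} i → r < q → EqSize (s * q + r) q (s + χ (i <? r))
eqSize-floorOrCeil s {r} {suc Q} i r<q with i <? r
... | no _ = inj₁ (trans (+-identityʳ s) (sym ([m*n+o]/n≡m s r<q)))
eqSize-floorOrCeil s {suc r} {suc Q} i r<q | yes _ =
  inj₂ (trans (+-comm s 1) (sym (trans (cong (_/ suc Q) (carry s Q r)) ([m*n+o]/n≡m (suc s) (<-trans (n<1+n r) r<q)))))
  where
  carry : ∀ s Q r → s * suc Q + suc r + Q ≡ suc s * suc Q + r
  carry = solve-∀

eqSize≥ : ∀ {N q x} c → 0 < q → c * q ≤ N → EqSize N q x → c ≤ x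
eqSize≥ {N} {suc Q} c _ cq≤N size = ≤-trans floor≥c (floor≤ size)
  where
  floor≥c : c ≤ N / suc Q
  floor≥c = subst (_≤ N / suc Q) (m*n/n≡m c (suc Q)) (/-monoˡ-≤ (suc Q) cq≤N)
  floor≤ : ∀ {x} → EqSize N (suc Q) x → N / suc Q ≤ x
  floor≤ (inj₁ refl) = ≤-refl
  floor≤ (inj₂ refl) = /-monoˡ-≤ (suc Q) (m≤m+n N Q)

eqSize≤ : ∀ {N q x} c → 0 < q → N ≤ c * q → EqSize N q x → x ≤ c
eqSize≤ {N} {suc Q} c _ N≤cq size = ≤-pred (≤-<-trans (≤ceil size) (m<n*o⇒m/o<n ceil-arg<))
  where
  ≤ceil : ∀ {x} → EqSize N (suc Q) x → x ≤ (N + Q) / suc Q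
  ≤ceil (inj₁ refl) = /-monoˡ-≤ (suc Q) (m≤m+n N Q)
  ≤ceil (inj₂ refl) = ≤-refl
  ceil-arg< : N + Q < suc c * suc Q
  ceil-arg< = subst (N + Q <_) (+-comm (c * suc Q) (suc Q)) (+-mono-≤-< N≤cq (n<1+n Q))

-- Colour classes in an arbitrary graph

module _ (G : Graph) {q : ℕ} (col : Fin (N G) → Fin q) where

  classSize≡sum : ∀ i → classSize G col i ≡ ∑[ u < N G ] χ (col u ≟ i)
  classSize≡sum i = count≡sum (λ u → col u ≟ i) (N G) id

  classDeg≡sum : ∀ v → classDeg G col v ≡ ∑[ u < N G ] χ (adj? G v u ×-dec (col u ≟ col v))
  classDeg≡sum v = count≡sum (λ u → adj? G v u ×-dec (col u ≟ col v)) (N G) id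

  sum-classSize : ∑[ i < q ] classSize G col i ≡ N G
  sum-classSize = begin
    ∑[ i < q ] classSize G col i                 ≡⟨ sum-cong-≗ classSize≡sum ⟩
    ∑[ i < q ] ∑[ u < N G ] χ (col u ≟ i)        ≡⟨ ∑-comm (λ i u → χ (col u ≟ i)) ⟩
    ∑[ u < N G ] ∑[ i < q ] χ (col u ≟ i)        ≡⟨ sum-cong-≗ {N G} (λ u → trans (sum-cong-≗ {q} (λ i → χ-cong sym sym _ _)) (sum-indicator q (col u))) ⟩
    ∑[ u < N G ] 1                               ≡⟨ trans (sum-const (N G) 1) (*-identityʳ (N G)) ⟩
    N G                                          ∎
    where open ≡-Reasoning

  classDeg<classSize : ∀ v → classDeg G col v < classSize G col (col v)
  classDeg<classSize v = begin-strict
    classDeg G col v                                    ≡⟨ classDeg≡sum v ⟩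
    ∑[ u < N G ] sameClassNeighbour u                   <⟨ m<m+n _ (s≤s z≤n) ⟩
    ∑[ u < N G ] sameClassNeighbour u + 1               ≡⟨ cong (∑[ u < N G ] sameClassNeighbour u +_) (sym (sum-indicator (N G) v)) ⟩
    ∑[ u < N G ] sameClassNeighbour u + ∑[ u < N G ] χ (u ≟ v)
                                                        ≡⟨ sym (∑-distrib-+ sameClassNeighbour _) ⟩
    ∑[ u < N G ] (sameClassNeighbour u + χ (u ≟ v))     ≤⟨ sum-mono-≤ (N G) inClass ⟩
    ∑[ u < N G ] χ (col u ≟ col v)                      ≡⟨ sym (classSize≡sum (col v)) ⟩
    classSize G col (col v)                             ∎
    where
    open ≤-Reasoning
    sameClassNeighbour : Fin (N G) → ℕ
    sameClassNeighbour u = χ (adj? G v u ×-dec (col u ≟ col v))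
    inClass : ∀ u → sameClassNeighbour u + χ (u ≟ v) ≤ χ (col u ≟ col v)
    inClass u with u ≟ v
    ... | yes refl = ≤-reflexive (cong₂ _+_ (χ-no (λ (adj , _) → irr G adj) _) (sym (χ-yes refl (col u ≟ col u))))
    ... | no _     = ≤-trans (≤-reflexive (+-identityʳ _)) (χ-mono proj₂ _ _)

  two-neighbours⇒classDeg≥2 : ∀ {v x y} → x ≢ y → Adj G v x → Adj G v y →
    col x ≡ col v → col y ≡ col v → 2 ≤ classDeg G col v
  two-neighbours⇒classDeg≥2 {v} {x} {y} x≢y vx vy cx cy = begin
    2                                                   ≡⟨ sym (cong₂ _+_ (sum-indicator (N G) x) (sum-indicator (N G) y)) ⟩
    ∑[ u < N G ] χ (u ≟ x) + ∑[ u < N G ] χ (u ≟ y)     ≡⟨ sym (∑-distrib-+ (λ u → χ (u ≟ x)) _) ⟩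
    ∑[ u < N G ] (χ (u ≟ x) + χ (u ≟ y))                ≤⟨ sum-mono-≤ (N G) x-or-y ⟩
    ∑[ u < N G ] χ (adj? G v u ×-dec (col u ≟ col v))   ≡⟨ sym (classDeg≡sum v) ⟩
    classDeg G col v                                    ∎
    where
    open ≤-Reasoning
    x-or-y : ∀ u → χ (u ≟ x) + χ (u ≟ y) ≤ χ (adj? G v u ×-dec (col u ≟ col v))
    x-or-y u with u ≟ x | u ≟ y
    ... | yes refl | yes refl = ⊥-elim (x≢y refl)
    ... | yes refl | no _     = ≤-reflexive (sym (χ-yes (vx , cx) _))
    ... | no _     | yes refl = ≤-reflexive (sym (χ-yes (vy , cy) _))
    ... | no _     | no _     = z≤n

  classDeg≤1⇒acyclic : (∀ v → classDeg G col v ≤ 1) → ∀ i → ¬ MonoCycle G col i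
  classDeg≤1⇒acyclic deg≤1 i cycle = 1+n≰n (≤-trans degree≥2 (deg≤1 (cyc zero)))
    where
    open MonoCycle cycle
    degree≥2 : 2 ≤ classDeg G col (cyc zero)
    degree≥2 = two-neighbours⇒classDeg≥2 (λ e → case inj e of λ ()) (step zero) (Graph.sym G close)
      (trans (mono _) (sym (mono zero))) (trans (mono _) (sym (mono zero)))

  third-in-class : ∀ {i} → 3 ≤ classSize G col i → ∀ u v → ∃ λ w → col w ≡ i × w ≢ u × w ≢ v
  third-in-class {i} big u v = let (w , pw) = sum-pos⇒∃ (N G) (χ ∘ other?) some-other in w , χ-pos (other? w) pw
    where
    other? : ∀ w → Dec (col w ≡ i × w ≢ u × w ≢ v)
    other? w = (col w ≟ i) ×-dec (¬? (w ≟ u) ×-dec ¬? (w ≟ v))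
    cover : ∀ w → χ (col w ≟ i) ≤ χ (w ≟ u) + χ (w ≟ v) + χ (other? w)
    cover w with w ≟ u | w ≟ v | col w ≟ i
    ... | yes _ | _     | _     = ≤-trans (χ≤1 _) (s≤s z≤n)
    ... | no _  | yes _ | _     = ≤-trans (χ≤1 _) (s≤s z≤n)
    ... | no _  | no _  | yes _ = s≤s z≤n
    ... | no _  | no _  | no _  = z≤n
    some-other : 0 < ∑[ w < N G ] χ (other? w)
    some-other = +-cancelˡ-≤ 2 1 _ (begin
      3                                                              ≤⟨ big ⟩
      classSize G col i                                              ≡⟨ classSize≡sum i ⟩
      ∑[ w < N G ] χ (col w ≟ i)                                     ≤⟨ sum-mono-≤ (N G) cover ⟩
      ∑[ w < N G ] (χ (w ≟ u) + χ (w ≟ v) + χ (other? w))            ≡⟨ ∑-distrib-+ (λ w → χ (w ≟ u) + χ (w ≟ v)) _ ⟩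
      ∑[ w < N G ] (χ (w ≟ u) + χ (w ≟ v)) + ∑[ w < N G ] χ (other? w)
                                                                     ≡⟨ cong (_+ ∑[ w < N G ] χ (other? w)) (trans (∑-distrib-+ (λ w → χ (w ≟ u)) _)
                                                                          (cong₂ _+_ (sum-indicator (N G) u) (sum-indicator (N G) v))) ⟩
      2 + ∑[ w < N G ] χ (other? w)                                  ∎)
      where open ≤-Reasoning

classDeg≤1⇒treeColoring : ∀ G {q} (col : Fin (N G) → Fin q) → (∀ i → EqSize (N G) q (classSize G col i)) →
  (∀ v → classDeg G col v ≤ 1) → EquitableTreeColoring G q 1
classDeg≤1⇒treeColoring G col sizes deg≤1 = record
  { col = col ; sizes = sizes ; acyclic = classDeg≤1⇒acyclic G col deg≤1 ; degBound = deg≤1 }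

residueColoring : ∀ G q → 0 < q → N G ≤ 2 * q → EquitableTreeColoring G q 1
residueColoring G (suc Q) _ N≤2q = classDeg≤1⇒treeColoring G col sizes deg≤1
  where
  q : ℕ
  q = suc Q
  col : Fin (N G) → Fin q
  col u = fromℕ< (m%n<n (toℕ u) q)
  N≡ : N G ≡ N G / q * q + N G % q
  N≡ = trans (m≡m%n+[m/n]*n (N G) q) (+-comm (N G % q) _)
  size : ∀ i → classSize G col i ≡ N G / q + χ (toℕ i <? N G % q)
  size i = begin
    classSize G col i                                   ≡⟨ classSize≡sum G col i ⟩
    ∑[ u < N G ] χ (col u ≟ i)                          ≡⟨ sum-cong-≗ {N G} (λ u → χ-fromℕ<≟ _ i) ⟩
    sumTo (N G) (λ w → χ (w % q ℕ.≟ toℕ i))             ≡⟨ cong (λ N′ → sumTo N′ (λ w → χ (w % q ℕ.≟ toℕ i))) N≡ ⟩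
    sumTo (N G / q * q + N G % q) (λ w → χ (w % q ℕ.≟ toℕ i))
                                                        ≡⟨ count-% (N G / q) (toℕ i) (m%n<n (N G) q) (toℕ<n i) ⟩
    N G / q + χ (toℕ i <? N G % q)                      ∎
    where open ≡-Reasoning
  sizes : ∀ i → EqSize (N G) q (classSize G col i)
  sizes i = subst₂ (λ N′ x → EqSize N′ q x) (sym N≡) (sym (size i)) (eqSize-floorOrCeil (N G / q) (toℕ i) (m%n<n (N G) q))
  deg≤1 : ∀ v → classDeg G col v ≤ 1
  deg≤1 v = ≤-pred (<-≤-trans (classDeg<classSize G col v) (eqSize≤ 2 (s≤s z≤n) N≤2q (sizes (col v))))

numPairs : ∀ G {q} → (Fin (N G) → Fin q) → ℕ
numPairs G {q} col = ∑[ i < q ] χ (classSize G col i ℕ.≟ 2)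

pairsAndTriples-count : ∀ G {q} (col : Fin (N G) → Fin q) →
  (∀ i → classSize G col i ≡ 2 ⊎ classSize G col i ≡ 3) → N G + numPairs G col ≡ 3 * q
pairsAndTriples-count G {q} col size∈23 = begin
  N G + numPairs G col                                             ≡⟨ cong (_+ numPairs G col) (sym (sum-classSize G col)) ⟩
  ∑[ i < q ] classSize G col i + numPairs G col                    ≡⟨ sym (∑-distrib-+ (classSize G col) _) ⟩
  ∑[ i < q ] (classSize G col i + χ (classSize G col i ℕ.≟ 2))     ≡⟨ sum-cong-≗ {q} three ⟩
  ∑[ i < q ] 3                                                     ≡⟨ trans (sum-const q 3) (*-comm q 3) ⟩
  3 * q                                                            ∎
  where
  open ≡-Reasoning
  three : ∀ i → classSize G col i + χ (classSize G col i ℕ.≟ 2) ≡ 3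
  three i with size∈23 i
  ... | inj₁ two   rewrite two   = refl
  ... | inj₂ three rewrite three = refl

-- Colour classes in complete multipartite graphs

quotient-combine : ∀ {k} n (p : Fin k) (j : Fin n) → quotient {k} n (combine p j) ≡ p
quotient-combine n p j = cong proj₁ (remQuot-combine p j)

remainder-combine : ∀ {k} n (p : Fin k) (j : Fin n) → remainder {k} n (combine p j) ≡ j
remainder-combine n p j = cong proj₂ (remQuot-combine p j)

module _ (k n : ℕ) {q : ℕ} (col : Fin (k * n) → Fin q) where

  partCount : Fin k → Fin q → ℕ
  partCount p i = ∑[ j < n ] χ (col (combine p j) ≟ i)

  sum-partCount : ∀ i → ∑[ p < k ] partCount p i ≡ classSize (K* k n) col i
  sum-partCount i = sym (trans (classSize≡sum (K* k n) col i) (sum-combine k n _))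

  sum-partCount-colors : ∀ p → ∑[ i < q ] partCount p i ≡ n
  sum-partCount-colors p = begin
    ∑[ i < q ] ∑[ j < n ] χ (col (combine p j) ≟ i)    ≡⟨ ∑-comm (λ i j → χ (col (combine p j) ≟ i)) ⟩
    ∑[ j < n ] ∑[ i < q ] χ (col (combine p j) ≟ i)    ≡⟨ sum-cong-≗ {n} (λ j → trans (sum-cong-≗ {q} (λ i → χ-cong sym sym _ _))
                                                                           (sum-indicator q (col (combine p j)))) ⟩
    ∑[ j < n ] 1                                       ≡⟨ trans (sum-const n 1) (*-identityʳ n) ⟩
    n                                                  ∎
    where open ≡-Reasoning

  classInOnePart⇒classDeg≡0 : ∀ v → (∀ u → col u ≡ col v → quotient {k} n u ≡ quotient {k} n v) →
    classDeg (K* k n) col v ≡ 0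
  classInOnePart⇒classDeg≡0 v inPart = trans (classDeg≡sum (K* k n) col v)
    (sum-zero (k * n) _ (λ u → χ-no (λ (adj , same) → adj (sym (inPart u same))) _))

  module _ (deg≤1 : ∀ v → classDeg (K* k n) col v ≤ 1) where

    private
      overloaded : ∀ {x} → ¬ 2 ≤ classDeg (K* k n) col x
      overloaded {x} deg≥2 = 1+n≰n (≤-trans deg≥2 (deg≤1 x))

    -- A third vertex of the class is adjacent to u or to v, which then has two neighbours in its class.
    bigClass⇒inOnePart : ∀ {i u v} → 3 ≤ classSize (K* k n) col i → col u ≡ i → col v ≡ i →
      quotient {k} n u ≡ quotient {k} n v
    bigClass⇒inOnePart {i} {u} {v} big cu cv with quotient {k} n u ≟ quotient {k} n v
    ... | yes same = same
    ... | no u~v   with third-in-class (K* k n) col big u v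
    ...   | w , cw , w≢u , w≢v with quotient {k} n w ≟ quotient {k} n u
    ...     | no w≁u   = ⊥-elim (overloaded (two-neighbours⇒classDeg≥2 (K* k n) col (λ v≡w → w≢v (sym v≡w))
                                   u~v (λ e → w≁u (sym e)) (trans cv (sym cu)) (trans cw (sym cu))))
    ...     | yes w∼u  = ⊥-elim (overloaded (two-neighbours⇒classDeg≥2 (K* k n) col (λ u≡w → w≢u (sym u≡w))
                                   (λ e → u~v (sym e)) (λ e → u~v (sym (trans e w∼u))) (trans cu (sym cv)) (trans cw (sym cv))))

    partCount-bigClass : ∀ {i} p → 3 ≤ classSize (K* k n) col i →
      partCount p i ≡ 0 ⊎ partCount p i ≡ classSize (K* k n) col i
    partCount-bigClass {i} p big with partCount p i in pc
    ... | zero  = inj₁ refl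
    ... | suc _ = inj₂ (sym (trans (sym (sum-partCount i)) (trans (sum-single k (λ p′ → partCount p′ i) p elsewhere) pc)))
      where
      witness : ∃ λ j → 0 < χ (col (combine p j) ≟ i)
      witness = sum-pos⇒∃ n (λ j → χ (col (combine p j) ≟ i)) (subst (0 <_) (sym pc) (s≤s z≤n))
      u : Fin (k * n)
      u = combine p (proj₁ witness)
      elsewhere : ∀ p′ → p′ ≢ p → partCount p′ i ≡ 0
      elsewhere p′ p′≢p = sum-zero n _ (λ j → χ-no (λ cj → p′≢p (begin
        p′                               ≡⟨ sym (quotient-combine n p′ j) ⟩
        quotient {k} n (combine p′ j)    ≡⟨ bigClass⇒inOnePart big cj (χ-pos _ (proj₂ witness)) ⟩
        quotient {k} n u                 ≡⟨ quotient-combine n p (proj₁ witness) ⟩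
        p                                ∎)) _)
        where open ≡-Reasoning

    numColors≤ : (∀ i → 3 ≤ classSize (K* k n) col i) → q ≤ k * (n / 3)
    numColors≤ big = begin
      q                                      ≡⟨ sym (trans (sum-const q 1) (*-identityʳ q)) ⟩
      ∑[ i < q ] 1                           ≤⟨ sum-mono-≤ q occupied ⟩
      ∑[ i < q ] ∑[ p < k ] occupies p i     ≡⟨ ∑-comm (λ i p → occupies p i) ⟩
      ∑[ p < k ] ∑[ i < q ] occupies p i     ≤⟨ sum-mono-≤ k perPart ⟩
      ∑[ p < k ] (n / 3)                     ≡⟨ sum-const k (n / 3) ⟩
      k * (n / 3)                            ∎
      where
      open ≤-Reasoning
      occupies : Fin k → Fin q → ℕ
      occupies p i = χ (0 <? partCount p i)
      occupied : ∀ i → 1 ≤ ∑[ p < k ] occupies p i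
      occupied i = let (p , pos) = sum-pos⇒∃ k (λ p → partCount p i) (subst (0 <_) (sym (sum-partCount i)) (≤-trans (s≤s z≤n) (big i)))
                   in ≤-trans (≤-reflexive (sym (χ-yes pos _))) (term≤sum k (λ p → occupies p i) p)
      filled : ∀ p i → 3 * occupies p i ≤ partCount p i
      filled p i with 0 <? partCount p i
      ... | no _ = z≤n
      ... | yes pos with partCount-bigClass p (big i)
      ...   | inj₁ empty = ⊥-elim (<-irrefl (sym empty) pos)
      ...   | inj₂ whole = subst (3 ≤_) (sym whole) (big i)
      perPart : ∀ p → ∑[ i < q ] occupies p i ≤ n / 3
      perPart p = m*n≤o⇒n≤o/m 3 (begin
        3 * ∑[ i < q ] occupies p i          ≡⟨ *-distribˡ-sum 3 (occupies p) ⟩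
        ∑[ i < q ] (3 * occupies p i)        ≤⟨ sum-mono-≤ q (filled p) ⟩
        ∑[ i < q ] partCount p i             ≡⟨ sum-partCount-colors p ⟩
        n                                    ∎)

    -- Two-vertex classes must cover a part of size 3b + 2 up to a multiple of 3,
    -- because three-vertex classes meet a part in 0 or 3 vertices.
    k≤numPairs : ∀ b → n ≡ 3 * b + 2 → (∀ i → classSize (K* k n) col i ≡ 2 ⊎ classSize (K* k n) col i ≡ 3) →
      k ≤ numPairs (K* k n) col
    k≤numPairs b n≡3b+2 size∈23 = *-cancelʳ-≤ k (numPairs (K* k n) col) 2 (begin
      k * 2                                                 ≡⟨ sym (sum-const k 2) ⟩
      ∑[ p < k ] 2                                          ≤⟨ sum-mono-≤ k pairPart≥2 ⟩
      ∑[ p < k ] pairPart p                                 ≡⟨ ∑-comm (λ p i → isPair i * partCount p i) ⟩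
      ∑[ i < q ] ∑[ p < k ] (isPair i * partCount p i)      ≡⟨ sum-cong-≗ {q} (λ i → trans (sym (*-distribˡ-sum {k} (isPair i) _))
                                                                                          (cong (isPair i *_) (sum-partCount i))) ⟩
      ∑[ i < q ] (isPair i * classSize (K* k n) col i)      ≡⟨ sum-cong-≗ {q} pairSize ⟩
      ∑[ i < q ] (isPair i * 2)                             ≡⟨ sym (*-distribʳ-sum {q} 2 isPair) ⟩
      numPairs (K* k n) col * 2                             ∎)
      where
      open ≤-Reasoning
      isPair isTriple : Fin q → ℕ
      isPair i   = χ (classSize (K* k n) col i ℕ.≟ 2)
      isTriple i = χ (classSize (K* k n) col i ℕ.≟ 3)
      pairPart triplePart : Fin k → ℕ
      pairPart p   = ∑[ i < q ] (isPair i * partCount p i)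
      triplePart p = ∑[ i < q ] (isTriple i * partCount p i)
      pairSize : ∀ i → isPair i * classSize (K* k n) col i ≡ isPair i * 2
      pairSize i with size∈23 i
      ... | inj₁ two   rewrite two   = refl
      ... | inj₂ three rewrite three = refl
      pairOrTriple : ∀ p i → isPair i * partCount p i + isTriple i * partCount p i ≡ partCount p i
      pairOrTriple p i with size∈23 i
      ... | inj₁ two   rewrite two   = trans (+-identityʳ _) (*-identityˡ _)
      ... | inj₂ three rewrite three = *-identityˡ _
      3∣triple : ∀ p i → 3 ∣ isTriple i * partCount p i
      3∣triple p i with size∈23 i
      ... | inj₁ two   rewrite two   = divides 0 refl
      ... | inj₂ three with partCount-bigClass p (≤-reflexive (sym three))
      ...   | inj₁ empty rewrite three | empty = divides 0 refl
      ...   | inj₂ whole rewrite three | whole = divides 1 refl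
      partition : ∀ p → pairPart p + triplePart p ≡ 3 * b + 2
      partition p = trans (sym (∑-distrib-+ (λ i → isPair i * partCount p i) _))
                          (trans (sum-cong-≗ {q} (pairOrTriple p)) (trans (sum-partCount-colors p) n≡3b+2))
      pairPart≥2 : ∀ p → 2 ≤ pairPart p
      pairPart≥2 p with 2 ≤? pairPart p
      ... | yes ≥2 = ≥2
      ... | no  ≱2 = ⊥-elim (x≤1∧3∣y⇒x+y≢3b+2 b (≤-pred (≰⇒> ≱2)) (∣-sum q _ (3∣triple p)) (partition p))

-- The colourings for q ≥ kb + k

slotColor : ℕ → ℕ → ℕ
slotColor r w with w <? r * 3
... | yes _ = w / 3
... | no _  = r + (w ∸ r * 3) / 2

slotColor-triple : ∀ r {w} → w < r * 3 → slotColor r w ≡ w / 3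
slotColor-triple r {w} w<3r with w <? r * 3
... | yes _   = refl
... | no w≮3r = ⊥-elim (w≮3r w<3r)

slotColor-pair : ∀ r x → slotColor r (r * 3 + x) ≡ r + x / 2
slotColor-pair r x with r * 3 + x <? r * 3
... | yes x+3r<3r = ⊥-elim (n≮n _ (≤-trans x+3r<3r (m≤m+n (r * 3) x)))
... | no _        = cong (λ y → r + y / 2) (m+n∸m≡n (r * 3) x)

slotColor<r⇒triple : ∀ r {w} → slotColor r w < r → w < r * 3
slotColor<r⇒triple r {w} c<r with w <? r * 3
... | yes w<3r = w<3r
... | no _     = ⊥-elim (n≮n _ (≤-trans c<r (m≤m+n r _)))

slotColor< : ∀ r m {w} → w < r * 3 + m * 2 → slotColor r w < r + m
slotColor< r m {w} w<N with w <? r * 3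
... | yes w<3r = ≤-trans (m<n*o⇒m/o<n w<3r) (m≤m+n r m)
... | no w≮3r  = +-monoʳ-< r (m<n*o⇒m/o<n (+-cancelˡ-< (r * 3) _ _ (subst (_< r * 3 + m * 2) (sym (m+[n∸m]≡n (≮⇒≥ w≮3r))) w<N)))

count-slotColor : ∀ r m i → i < r + m → sumTo (r * 3 + m * 2) (λ w → χ (slotColor r w ℕ.≟ i)) ≡ 2 + χ (i <? r)
count-slotColor r m i i<q = begin
  sumTo (r * 3 + m * 2) h                                      ≡⟨ sumTo-+ (r * 3) (m * 2) h ⟩
  sumTo (r * 3) h + sumTo (m * 2) (λ x → h (r * 3 + x))        ≡⟨ cong₂ _+_ triples pairs ⟩
  3 * χ (i <? r) + χ (r ℕ.≤? i) * (2 * χ (i ∸ r <? m))           ≡⟨ total ⟩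
  2 + χ (i <? r)                                               ∎
  where
  open ≡-Reasoning
  h : ℕ → ℕ
  h w = χ (slotColor r w ℕ.≟ i)
  triples : sumTo (r * 3) h ≡ 3 * χ (i <? r)
  triples = trans (sumTo-cong (r * 3) (λ w w<3r → cong (λ c → χ (c ℕ.≟ i)) (slotColor-triple r w<3r))) (count-/ r i)
  pairs : sumTo (m * 2) (λ x → h (r * 3 + x)) ≡ χ (r ℕ.≤? i) * (2 * χ (i ∸ r <? m))
  pairs with r ℕ.≤? i
  ... | no i<r  = trans (sum-zero (m * 2) _ (λ x → χ-no (λ r+x≡i → i<r (subst (r ≤_) (trans (sym (slotColor-pair r (toℕ x))) r+x≡i) (m≤m+n r _))) _))
                        refl
  ... | yes r≤i = trans (sumTo-cong (m * 2) {h′ = λ x → χ (x / 2 ℕ.≟ i ∸ r)} (λ x _ → trans (cong (λ c → χ (c ℕ.≟ i)) (slotColor-pair r x)) (χ-cong shift unshift _ _)))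
                        (trans (count-/ m (i ∸ r)) (sym (+-identityʳ _)))
    where
    shift : ∀ {y} → r + y ≡ i → y ≡ i ∸ r
    shift {y} r+y≡i = trans (sym (m+n∸m≡n r y)) (cong (_∸ r) r+y≡i)
    unshift : ∀ {y} → y ≡ i ∸ r → r + y ≡ i
    unshift refl = m+[n∸m]≡n r≤i
  total : 3 * χ (i <? r) + χ (r ℕ.≤? i) * (2 * χ (i ∸ r <? m)) ≡ 2 + χ (i <? r)
  total with i <? r | r ℕ.≤? i
  ... | yes i<r | yes r≤i = ⊥-elim (<⇒≱ i<r r≤i)
  ... | yes _   | no _    = refl
  ... | no i≮r  | no r≰i  = ⊥-elim (r≰i (≮⇒≥ i≮r))
  ... | no _    | yes r≤i = cong (λ c → 1 * (2 * c)) (χ-yes (+-cancelˡ-< r _ _ (subst (_< r + m) (sym (m+[n∸m]≡n r≤i)) i<q)) (i ∸ r <? m))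

-- Vertex j of part p is placed at position p·3b + j if j < 3b, and after all of these
-- otherwise.  Hence, for c < kb, positions 3c, 3c+1, 3c+2 lie in part c / b.
module Layout (k b e : ℕ) where

  position : ℕ → ℕ → ℕ
  position p j with j <? 3 * b
  ... | yes _ = p * (3 * b) + j
  ... | no _  = k * (3 * b) + (p * e + (j ∸ 3 * b))

  position-front : ∀ p {j} → j < 3 * b → position p j ≡ p * (3 * b) + j
  position-front p {j} j<3b with j <? 3 * b
  ... | yes _   = refl
  ... | no j≮3b = ⊥-elim (j≮3b j<3b)

  position-back : ∀ p x → position p (3 * b + x) ≡ k * (3 * b) + (p * e + x)
  position-back p x with 3 * b + x <? 3 * b
  ... | yes x+3b<3b = ⊥-elim (n≮n _ (≤-trans x+3b<3b (m≤m+n (3 * b) x)))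
  ... | no _        = cong (λ y → k * (3 * b) + (p * e + y)) (m+n∸m≡n (3 * b) x)

  position< : ∀ {p j} → p < k → j < 3 * b + e → position p j < k * (3 * b + e)
  position< {p} {j} p<k j<n with j <? 3 * b
  ... | yes j<3b = <-≤-trans (p*n+j<k*n p<k j<3b) (subst (k * (3 * b) ≤_) (sym (*-distribˡ-+ k (3 * b) e)) (m≤m+n _ _))
  ... | no j≮3b  = subst (k * (3 * b) + (p * e + (j ∸ 3 * b)) <_) (sym (*-distribˡ-+ k (3 * b) e))
                     (+-monoʳ-< (k * (3 * b)) (p*n+j<k*n p<k (+-cancelˡ-< (3 * b) _ _ (subst (_< 3 * b + e) (sym (m+[n∸m]≡n (≮⇒≥ j≮3b))) j<n))))

  position-front⇒ : ∀ {p j} → position p j < k * (3 * b) → j < 3 * b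
  position-front⇒ {p} {j} front with j <? 3 * b
  ... | yes j<3b = j<3b
  ... | no _     = ⊥-elim (n≮n _ (≤-trans front (m≤m+n _ _)))

  sumTo-position : ∀ h → sumTo k (λ p → sumTo (3 * b + e) (λ j → h (position p j))) ≡ sumTo (k * (3 * b + e)) h
  sumTo-position h = begin
    sumTo k (λ p → sumTo (3 * b + e) (λ j → h (position p j)))
      ≡⟨ sumTo-cong k (λ p _ → trans (sumTo-+ (3 * b) e (λ j → h (position p j))) (cong₂ _+_
           (sumTo-cong (3 * b) (λ j j<3b → cong h (position-front p j<3b)))
           (sumTo-cong e (λ x _ → cong h (position-back p x))))) ⟩
    sumTo k (λ p → sumTo (3 * b) (λ j → h (p * (3 * b) + j)) + sumTo e (λ x → back (p * e + x)))
      ≡⟨ ∑-distrib-+ {k} (λ p → sumTo (3 * b) (λ j → h (toℕ p * (3 * b) + j))) _ ⟩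
    sumTo k (λ p → sumTo (3 * b) (λ j → h (p * (3 * b) + j))) + sumTo k (λ p → sumTo e (λ x → back (p * e + x)))
      ≡⟨ sym (cong₂ _+_ (sumTo-* k (3 * b) h) (sumTo-* k e back)) ⟩
    sumTo (k * (3 * b)) h + sumTo (k * e) back
      ≡⟨ sym (sumTo-+ (k * (3 * b)) (k * e) h) ⟩
    sumTo (k * (3 * b) + k * e) h
      ≡⟨ cong (λ N → sumTo N h) (sym (*-distribˡ-+ k (3 * b) e)) ⟩
    sumTo (k * (3 * b + e)) h
      ∎
    where
    open ≡-Reasoning
    back : ℕ → ℕ
    back w = h (k * (3 * b) + w)

  triple-in-part : ∀ r {p j} → r ≤ k * b → slotColor r (position p j) < r →
    ∃ λ x → x < b × slotColor r (position p j) ≡ p * b + x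
  triple-in-part r {p} {j} r≤kb c<r = j / 3 , m<n*o⇒m/o<n (subst (j <_) (*-comm 3 b) j<3b) , (begin
    slotColor r (position p j)          ≡⟨ slotColor-triple r w<3r ⟩
    position p j / 3                     ≡⟨ cong (_/ 3) (trans (position-front p j<3b) regroup) ⟩
    ((p * b + j / 3) * 3 + j % 3) / 3    ≡⟨ [m*n+o]/n≡m (p * b + j / 3) (m%n<n j 3) ⟩
    p * b + j / 3                        ∎)
    where
    open ≡-Reasoning
    w<3r : position p j < r * 3
    w<3r = slotColor<r⇒triple r c<r
    j<3b : j < 3 * b
    j<3b = position-front⇒ (<-≤-trans w<3r (subst (r * 3 ≤_) (trans (*-comm (k * b) 3) (identity k b)) (*-monoˡ-≤ 3 r≤kb)))
      where
      identity : ∀ k b → 3 * (k * b) ≡ k * (3 * b)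
      identity = solve-∀
    regroup : p * (3 * b) + j ≡ (p * b + j / 3) * 3 + j % 3
    regroup = trans (cong (p * (3 * b) +_) (trans (m≡m%n+[m/n]*n j 3) (+-comm (j % 3) _))) (ring p b (j / 3) (j % 3))
      where
      ring : ∀ p b x y → p * (3 * b) + (x * 3 + y) ≡ (p * b + x) * 3 + y
      ring = solve-∀

triplesAndPairs : ∀ k b e r m → r ≤ k * b → 0 < m → k * (3 * b + e) ≡ r * 3 + m * 2 →
  EquitableTreeColoring (K* k (3 * b + e)) (r + m) 1
triplesAndPairs k b e r m r≤kb m>0 N≡ = classDeg≤1⇒treeColoring (K* k n) col sizes deg≤1
  where
  open Layout k b e
  n : ℕ
  n = 3 * b + e
  colorOf : ℕ → ℕ → ℕ
  colorOf p j = slotColor r (position p j)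
  colorOf< : (p : Fin k) (j : Fin n) → colorOf (toℕ p) (toℕ j) < r + m
  colorOf< p j = slotColor< r m (subst (position (toℕ p) (toℕ j) <_) N≡ (position< (toℕ<n p) (toℕ<n j)))
  col : Fin (k * n) → Fin (r + m)
  col u = fromℕ< (colorOf< (quotient {k} n u) (remainder {k} n u))
  size : ∀ i → classSize (K* k n) col i ≡ 2 + χ (toℕ i <? r)
  size i = begin
    classSize (K* k n) col i                                          ≡⟨ classSize≡sum (K* k n) col i ⟩
    ∑[ u < k * n ] χ (col u ≟ i)                                      ≡⟨ sum-combine k n _ ⟩
    ∑[ p < k ] ∑[ j < n ] χ (col (combine p j) ≟ i)                   ≡⟨ sum-cong-≗ {k} (λ p → sum-cong-≗ {n} (λ j → trans (χ-fromℕ<≟ _ i)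
                                                                           (cong₂ (λ p′ j′ → χ (colorOf (toℕ p′) (toℕ j′) ℕ.≟ toℕ i))
                                                                                  (quotient-combine n p j) (remainder-combine n p j)))) ⟩
    sumTo k (λ p → sumTo n (λ j → χ (colorOf p j ℕ.≟ toℕ i)))        ≡⟨ sumTo-position (λ w → χ (slotColor r w ℕ.≟ toℕ i)) ⟩
    sumTo (k * n) (λ w → χ (slotColor r w ℕ.≟ toℕ i))                ≡⟨ cong (λ N → sumTo N (λ w → χ (slotColor r w ℕ.≟ toℕ i))) N≡ ⟩
    sumTo (r * 3 + m * 2) (λ w → χ (slotColor r w ℕ.≟ toℕ i))        ≡⟨ count-slotColor r m (toℕ i) (toℕ<n i) ⟩
    2 + χ (toℕ i <? r)                                                ∎
    where open ≡-Reasoning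
  sizes : ∀ i → EqSize (k * n) (r + m) (classSize (K* k n) col i)
  sizes i = subst₂ (λ N x → EqSize N (r + m) x) (sym (trans N≡ (regroup r m))) (sym (size i))
                   (eqSize-floorOrCeil 2 (toℕ i) (m<m+n r m>0))
    where
    regroup : ∀ r m → r * 3 + m * 2 ≡ 2 * (r + m) + r
    regroup = solve-∀
  part-of-triple : ∀ u → toℕ (col u) < r → ∃ λ x → x < b × toℕ (col u) ≡ toℕ (quotient {k} n u) * b + x
  part-of-triple u c<r =
    let (x , x<b , c≡) = triple-in-part r r≤kb (subst (_< r) (toℕ-fromℕ< _) c<r)
    in x , x<b , trans (toℕ-fromℕ< _) c≡
  deg≤1 : ∀ v → classDeg (K* k n) col v ≤ 1
  deg≤1 v with toℕ (col v) <? r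
  ... | yes triple = ≤-trans (≤-reflexive (classInOnePart⇒classDeg≡0 k n col v sameTriple)) z≤n
    where
    sameTriple : ∀ u → col u ≡ col v → quotient {k} n u ≡ quotient {k} n v
    sameTriple u cu≡cv =
      let (x , x<b , cu) = part-of-triple u (subst (λ c → toℕ c < r) (sym cu≡cv) triple)
          (y , y<b , cv) = part-of-triple v triple
      in toℕ-injective (slot-injective x<b y<b (trans (sym cu) (trans (cong toℕ cu≡cv) cv)))
  ... | no pair = ≤-pred (<-≤-trans (classDeg<classSize (K* k n) col v)
                                    (≤-reflexive (trans (size (col v)) (cong (2 +_) (χ-no pair (toℕ (col v) <? r))))))

coloringsFrom-kb+k : ∀ k b → 1 ≤ k → AllFrom (K* k (3 * b + 2)) 1 (k * b + k)
coloringsFrom-kb+k k b k≥1 q kb+k≤q with k * (3 * b + 2) ≤? 2 * q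
... | yes sparse = residueColoring (K* k (3 * b + 2)) q (≤-trans (≤-trans k≥1 (m≤n+m k (k * b))) kb+k≤q) sparse
... | no dense   = subst (λ q′ → EquitableTreeColoring (K* k (3 * b + 2)) q′ 1) (m+[n∸m]≡n (<⇒≤ r<q))
                     (triplesAndPairs k b 2 r (q ∸ r) r≤kb (m<n⇒0<n∸m r<q) N≡)
  where
  r : ℕ
  r = k * (3 * b + 2) ∸ 2 * q
  N≡2q+r : k * (3 * b + 2) ≡ 2 * q + r
  N≡2q+r = sym (m+[n∸m]≡n (<⇒≤ (≰⇒> dense)))
  r≤kb : r ≤ k * b
  r≤kb = m≤n+o⇒m∸n≤o _ (2 * q) (begin
    k * (3 * b + 2)           ≡⟨ regroup k b ⟩
    2 * (k * b + k) + k * b   ≤⟨ +-monoˡ-≤ (k * b) (*-monoʳ-≤ 2 kb+k≤q) ⟩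
    2 * q + k * b             ∎)
    where
    open ≤-Reasoning
    regroup : ∀ k b → k * (3 * b + 2) ≡ 2 * (k * b + k) + k * b
    regroup = solve-∀
  r<q : r < q
  r<q = <-≤-trans (≤-<-trans r≤kb (m<m+n (k * b) k≥1)) kb+k≤q
  N≡ : k * (3 * b + 2) ≡ r * 3 + (q ∸ r) * 2
  N≡ = trans N≡2q+r (trans (cong (λ q′ → 2 * q′ + r) (sym (m+[n∸m]≡n (<⇒≤ r<q)))) (regroup r (q ∸ r)))
    where
    regroup : ∀ r m → 2 * (r + m) + r ≡ r * 3 + m * 2
    regroup = solve-∀

noColoring-kb+k∸1 : ∀ k′ b → 1 ≤ k′ → ¬ EquitableTreeColoring (K* (suc k′) (3 * b + 2)) (suc k′ * b + k′) 1
noColoring-kb+k∸1 k′ b k′≥1 E = case k′ ≤? 2 of λ where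
    (yes k′≤2) → <⇒≱ (m<m+n (k * b) k′≥1) (q≤kb k′≤2)
    (no k′≰2)  → <⇒≱ (numPairs<k (<⇒≤ (≰⇒> k′≰2))) (k≤numPairs k n col degBound b refl (twoOrThree (<⇒≤ (≰⇒> k′≰2))))
  where
  open EquitableTreeColoring E
  k n q : ℕ
  k = suc k′
  n = 3 * b + 2
  q = k * b + k′
  q>0 : 0 < q
  q>0 = ≤-trans k′≥1 (m≤n+m k′ (k * b))
  excess : k * n + k′ ≡ 3 * q + 2
  excess = identity k′ b
    where
    identity : ∀ k′ b → suc k′ * (3 * b + 2) + k′ ≡ 3 * (suc k′ * b + k′) + 2
    identity = solve-∀
  2q≤kn : 2 * q ≤ k * n
  2q≤kn = subst (2 * q ≤_) (sym (identity k′ b)) (m≤m+n (2 * q) _)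
    where
    identity : ∀ k′ b → suc k′ * (3 * b + 2) ≡ 2 * (suc k′ * b + k′) + (suc k′ * b + 2)
    identity = solve-∀
  q≤kb : k′ ≤ 2 → q ≤ k * b
  q≤kb k′≤2 = subst (λ c → q ≤ k * c) n/3≡b (numColors≤ k n col degBound (λ i → eqSize≥ 3 q>0 3q≤kn (sizes i)))
    where
    3q≤kn : 3 * q ≤ k * n
    3q≤kn = +-cancelʳ-≤ 2 (3 * q) (k * n) (subst (_≤ k * n + 2) excess (+-monoʳ-≤ (k * n) k′≤2))
    n/3≡b : n / 3 ≡ b
    n/3≡b = trans (cong (λ m → (m + 2) / 3) (*-comm 3 b)) ([m*n+o]/n≡m b (s≤s (s≤s (s≤s z≤n))))
  kn≤3q : 2 ≤ k′ → k * n ≤ 3 * q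
  kn≤3q k′≥2 = +-cancelʳ-≤ 2 (k * n) (3 * q) (subst (k * n + 2 ≤_) excess (+-monoʳ-≤ (k * n) k′≥2))
  twoOrThree : 2 ≤ k′ → ∀ i → classSize (K* k n) col i ≡ 2 ⊎ classSize (K* k n) col i ≡ 3
  twoOrThree k′≥2 i with m≤n⇒m<n∨m≡n (eqSize≤ 3 q>0 (kn≤3q k′≥2) (sizes i))
  ... | inj₁ <3 = inj₁ (≤-antisym (≤-pred <3) (eqSize≥ 2 q>0 2q≤kn (sizes i)))
  ... | inj₂ ≡3 = inj₂ ≡3
  numPairs<k : 2 ≤ k′ → numPairs (K* k n) col < k
  numPairs<k k′≥2 = <-trans (subst (X <_) X+2≡k′ (m<m+n X (s≤s z≤n))) (n<1+n k′)
    where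
    X : ℕ
    X = numPairs (K* k n) col
    X+2≡k′ : X + 2 ≡ k′
    X+2≡k′ = +-cancelˡ-≡ (k * n) (X + 2) k′ (begin
      k * n + (X + 2)    ≡⟨ sym (+-assoc (k * n) X 2) ⟩
      k * n + X + 2      ≡⟨ cong (_+ 2) (pairsAndTriples-count (K* k n) col (twoOrThree k′≥2)) ⟩
      3 * q + 2          ≡⟨ sym excess ⟩
      k * n + k′         ∎)
      where open ≡-Reasoning

lemma16 : ∀ (k b : ℕ) → 2 ≤ k → 1 ≤ b →
    IsStrongEqVA (K* k (3 * b + 2)) 1 (k * b + k)
lemma16 (suc k′) b (s≤s k′≥1) _ = coloringsFrom-kb+k (suc k′) b (s≤s z≤n) , minimal
  where
  minimal : ∀ p → p < suc k′ * b + suc k′ → ¬ AllFrom (K* (suc k′) (3 * b + 2)) 1 p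
  minimal p p<kb+k colorings = noColoring-kb+k∸1 k′ b k′≥1 (colorings (suc k′ * b + k′) (≤-pred (subst (p <_) (+-suc _ k′) p<kb+k)))
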